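{- Let $\Gamma\subset\mathbb{N}_\infty^n$ be a multicomplex and let $\Gamma=\bigcup_{i=1}^t[a_i,b_i]$ be a partition of $\Gamma$ (a presentation of $\Gamma$ as a finite disjoint union of intervals). Then $\operatorname{infpt}(a_i)=\emptyset$ for all $i=1,\ldots,t$.
   Context: $\mathbb{N}_\infty=\mathbb{N}\cup\{\infty\}$ with $a\le\infty$ for all $a$; $\mathbb{N}_\infty^n$ carries the componentwise partial order. An element $m\in\Gamma$ is maximal if there is no $a\in\Gamma$ with $a>m$; $\mathcal{M}(\Gamma)$ denotes the set of maximal elements. A subset $\Gamma\subset\mathbb{N}_\infty^n$ is a multicomplex if (1) for all $a\in\Gamma$ and all $b\in\mathbb{N}_\infty^n$ with $b\le a$ one has $b\in\Gamma$, and (2) for every $a\in\Gamma$ there is $m\in\mathcal{M}(\Gamma)$ with $a\le m$. For $a\in\mathbb{N}_\infty^n$, $\operatorname{infpt}(a)=\{i: a(i)=\infty\}$. An interval of $\Gamma$ is a set $[a,b]=\{c\in\Gamma: a\le c\le b\}$ for some $a\le b$ in $\Gamma$. A partition of $\Gamma$ is a presentation of $\Gamma$ as a finite disjoint union of intervals. -}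

module Defs where

open import Data.Nat using (ℕ)
import Data.Nat as ℕ
open import Data.Fin using (Fin)
open import Data.Product using (Σ; ∃; _×_)
open import Relation.Nullary using (¬_)
open import Relation.Binary.PropositionalEquality using (_≡_; _≢_)
open import Level using (Level; suc; _⊔_)

data ℕ∞ : Set where
  fin : ℕ → ℕ∞
  ∞   : ℕ∞

infix 4 _≤∞_ _≤_ _<_
data _≤∞_ : ℕ∞ → ℕ∞ → Set where
  fin≤fin : ∀ {m n} → m ℕ.≤ n → fin m ≤∞ fin n
  ≤∞-top  : ∀ {a} → a ≤∞ ∞

Vec∞ : ℕ → Set
Vec∞ n = Fin n → ℕ∞

_≤_ : ∀ {n} → Vec∞ n → Vec∞ n → Set
a ≤ b = ∀ j → a j ≤∞ b j

_<_ : ∀ {n} → Vec∞ n → Vec∞ n → Set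
a < b = a ≤ b × ¬ (b ≤ a)

Subset∞ : ∀ ℓ → ℕ → Set (suc ℓ)
Subset∞ ℓ n = Vec∞ n → Set ℓ

IsMaximal : ∀ {ℓ n} → Subset∞ ℓ n → Vec∞ n → Set ℓ
IsMaximal Γ m = Γ m × ¬ (Σ (Vec∞ _) λ a → Γ a × m < a)

record IsMulticomplex {ℓ n} (Γ : Subset∞ ℓ n) : Set ℓ where
  field
    downClosed : ∀ a b → Γ a → b ≤ a → Γ b
    belowMax   : ∀ a → Γ a → Σ (Vec∞ n) λ m → IsMaximal Γ m × a ≤ m

infpt : ∀ {n} → Vec∞ n → Fin n → Set
infpt a j = a j ≡ ∞

InInterval : ∀ {ℓ n} → Subset∞ ℓ n → Vec∞ n → Vec∞ n → Vec∞ n → Set ℓ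
InInterval Γ a b c = Γ c × a ≤ c × c ≤ b

record IsPartition {ℓ n t} (Γ : Subset∞ ℓ n) (a b : Fin t → Vec∞ n) : Set ℓ where
  field
    endpointsIn : ∀ i → Γ (a i) × Γ (b i) × a i ≤ b i
    covers      : ∀ c → Γ c → ∃ λ i → InInterval Γ (a i) (b i) c
    disjoint    : ∀ i k c → i ≢ k → InInterval Γ (a i) (b i) c → ¬ InInterval Γ (a k) (b k) c

module Submission where

-- Suppose aᵢ(j) = ∞.  Choose M larger than every finite value
-- among the j-th coordinates b₁(j), …, bₜ(j) of the upper endpoints, and let
-- c be aᵢ with its j-th coordinate lowered to M + 1.  Then c ≤ aᵢ, so c ∈ Γ
-- (Γ is down-closed) and c lies in some interval [aₗ, bₗ].  Since
-- bₗ(j) ≥ M + 1, the choice of M forces bₗ(j) = ∞, and as c agrees with aᵢ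
-- off j this gives aᵢ ≤ bₗ; also aₗ ≤ c ≤ aᵢ, so aᵢ ∈ [aₗ, bₗ].  If l = i,
-- then ∞ = aᵢ(j) ≤ c(j) = M + 1, which is absurd; if l ≠ i, then aᵢ lies in
-- the two disjoint intervals [aᵢ, bᵢ] and [aₗ, bₗ].

open import Defs
open import Data.Nat using (ℕ)
open import Data.Fin using (Fin)
open import Level using (Level)
open import Relation.Nullary using (¬_; yes; no)
import Data.Nat as ℕ
import Data.Nat.Properties as ℕ
import Data.Fin as Fin
open import Data.Vec.Functional using (updateAt)
open import Data.Vec.Functional.Properties using (updateAt-updates; updateAt-minimal)
open import Data.Product using (Σ; ∃; _,_; proj₁; proj₂)
open import Data.Empty using (⊥-elim)
open import Function using (const)
open import Relation.Binary.PropositionalEquality using (_≡_; refl; sym; subst; subst₂)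

≤∞-refl : ∀ x → x ≤∞ x
≤∞-refl (fin x) = fin≤fin ℕ.≤-refl
≤∞-refl ∞       = ≤∞-top

≤∞-trans : ∀ {x y z} → x ≤∞ y → y ≤∞ z → x ≤∞ z
≤∞-trans (fin≤fin p) (fin≤fin q) = fin≤fin (ℕ.≤-trans p q)
≤∞-trans _           ≤∞-top      = ≤∞-top

≤-refl : ∀ {n} (a : Vec∞ n) → a ≤ a
≤-refl a j = ≤∞-refl (a j)

≤-trans : ∀ {n} {a b c : Vec∞ n} → a ≤ b → b ≤ c → a ≤ c
≤-trans p q j = ≤∞-trans (p j) (q j)

≤∞-≡∞ : ∀ {x y} → y ≡ ∞ → x ≤∞ y
≤∞-≡∞ refl = ≤∞-top

∞≰fin : ∀ m → ¬ (∞ ≤∞ fin m)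
∞≰fin m ()

finitePart : ℕ∞ → ℕ
finitePart (fin m) = m
finitePart ∞       = 0

beyondFinitePart⇒∞ : ∀ {M} y → finitePart y ℕ.≤ M → fin (ℕ.suc M) ≤∞ y → y ≡ ∞
beyondFinitePart⇒∞ (fin m) m≤M (fin≤fin M<m) = ⊥-elim (ℕ.<⇒≱ M<m m≤M)
beyondFinitePart⇒∞ ∞       _   _             = refl

upperBound : ∀ {t} (f : Fin t → ℕ) → Σ ℕ λ M → ∀ l → f l ℕ.≤ M
upperBound {ℕ.zero}  f = 0 , λ ()
upperBound {ℕ.suc t} f with upperBound (λ l → f (Fin.suc l))
... | M , f≤M = f Fin.zero ℕ.+ M , λ
  { Fin.zero    → ℕ.m≤m+n (f Fin.zero) M
  ; (Fin.suc l) → ℕ.≤-trans (f≤M l) (ℕ.m≤n+m M (f Fin.zero)) }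

_[_]≔_ : ∀ {n} → Vec∞ n → Fin n → ℕ∞ → Vec∞ n
a [ j ]≔ x = updateAt a j (const x)

lowered≤ : ∀ {n} (a : Vec∞ n) j {x} → x ≤∞ a j → a [ j ]≔ x ≤ a
lowered≤ a j x≤aj k with k Fin.≟ j
... | yes refl = subst (_≤∞ a j) (sym (updateAt-updates j a)) x≤aj
... | no k≢j   = subst (_≤∞ a k) (sym (updateAt-minimal k j a k≢j)) (≤∞-refl (a k))

replaced≤⇒≤ : ∀ {n} (a b : Vec∞ n) j {x} → a [ j ]≔ x ≤ b → a j ≤∞ b j → a ≤ b
replaced≤⇒≤ a b j a[j]≤b aj≤bj k with k Fin.≟ j
... | yes refl = aj≤bj
... | no k≢j   = subst (_≤∞ b k) (updateAt-minimal k j a k≢j) (a[j]≤b k)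

lowerEndpointInInterval : ∀ {ℓ n t} {Γ : Subset∞ ℓ n} {a b : Fin t → Vec∞ n}
                        → IsPartition Γ a b → ∀ i → InInterval Γ (a i) (b i) (a i)
lowerEndpointInInterval P i with IsPartition.endpointsIn P i
... | Γaᵢ , _ , aᵢ≤bᵢ = Γaᵢ , ≤-refl _ , aᵢ≤bᵢ

lemma1p2 : ∀ {ℓ : Level} {n t : ℕ} (Γ : Subset∞ ℓ n) (a b : Fin t → Vec∞ n)
           → IsMulticomplex Γ → IsPartition Γ a b
           → ∀ i j → ¬ infpt (a i) j
lemma1p2 Γ a b MC P i j aᵢⱼ≡∞ = notCovered (IsPartition.covers P c Γc)
  where
    bounded : Σ ℕ λ M → ∀ l → finitePart (b l j) ℕ.≤ M
    bounded = upperBound (λ l → finitePart (b l j))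

    M : ℕ
    M = proj₁ bounded

    c : Vec∞ _
    c = a i [ j ]≔ fin (ℕ.suc M)

    cⱼ≡M+1 : c j ≡ fin (ℕ.suc M)
    cⱼ≡M+1 = updateAt-updates j (a i)

    c≤aᵢ : c ≤ a i
    c≤aᵢ = lowered≤ (a i) j (≤∞-≡∞ aᵢⱼ≡∞)

    Γaᵢ : Γ (a i)
    Γaᵢ = proj₁ (lowerEndpointInInterval P i)

    Γc : Γ c
    Γc = IsMulticomplex.downClosed MC (a i) c Γaᵢ c≤aᵢ

    notCovered : ¬ ∃ λ l → InInterval Γ (a l) (b l) c
    notCovered (l , _ , aₗ≤c , c≤bₗ) with i Fin.≟ l
    ... | yes refl = ∞≰fin (ℕ.suc M) (subst₂ _≤∞_ aᵢⱼ≡∞ cⱼ≡M+1 (aₗ≤c j))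
    ... | no i≢l   = IsPartition.disjoint P i l (a i) i≢l
                       (lowerEndpointInInterval P i) (Γaᵢ , ≤-trans aₗ≤c c≤aᵢ , aᵢ≤bₗ)
      where
        -- bₗ(j) ≥ c(j) = M + 1 exceeds the bound, so bₗ(j) = ∞ …
        bₗⱼ≡∞ : b l j ≡ ∞
        bₗⱼ≡∞ = beyondFinitePart⇒∞ (b l j) (proj₂ bounded l) (subst (_≤∞ b l j) cⱼ≡M+1 (c≤bₗ j))

        -- … hence aᵢ ≤ bₗ, since c ≤ bₗ and c agrees with aᵢ off j.
        aᵢ≤bₗ : a i ≤ b l
        aᵢ≤bₗ = replaced≤⇒≤ (a i) (b l) j c≤bₗ (≤∞-≡∞ bₗⱼ≡∞)
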